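{- For every integer $a \geq 3$, $\mathcal{G}_{\mathcal{R}}(1,a) = \mathcal{G}_{\mathcal{R}}(2,a) = a$.
   Context: A position is an unordered pair $(a,b)$ of nonnegative integers (pile sizes). $\mathcal{R}$-Wythoff: a move either removes a positive number of tokens from the larger pile (or from either pile if both piles have equal size), or removes the same positive number of tokens from both piles. $\mathcal{G}_{\mathcal{R}}$ is the Sprague-Grundy function of $\mathcal{R}$-Wythoff: $\mathcal{G}_{\mathcal{R}}(p)=\mathrm{mex}\{\mathcal{G}_{\mathcal{R}}(q): q \text{ reachable from } p \text{ in one move}\}$, where $\mathrm{mex}(S)$ is the least nonnegative integer not in $S$ and $\mathrm{mex}\{\}=0$. -}

module Defs where

open import Data.Nat using (ℕ; zero; suc; _+_; _∸_; _⊔_; _⊓_; _≡ᵇ_)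
open import Data.Bool using (Bool; if_then_else_)
open import Data.List using (List; []; _∷_; map; length; upTo; _++_)
open import Data.Bool.ListAction using (any)
open import Data.Product using (_×_; _,_)

-- mex of a finite list: least n not in the list (the answer is ≤ length xs,
-- so a search over candidates 0 .. length xs suffices).
elemᵇ : ℕ → List ℕ → Bool
elemᵇ n xs = any (n ≡ᵇ_) xs

mexAux : ℕ → ℕ → List ℕ → ℕ
mexAux zero    n xs = n
mexAux (suc f) n xs = if elemᵇ n xs then mexAux f (suc n) xs else n

mex : List ℕ → ℕ
mex xs = mexAux (length xs) 0 xs

-- R-Wythoff moves from the (unordered) position {a , b}.
-- With lo = min, hi = max:
--   * remove t ≥ 1 tokens from the larger pile: (lo , k) for k < hi
--     (if a = b, removing from either pile gives the same unordered position);
--   * remove t ≥ 1 tokens from both piles: (lo ∸ t , hi ∸ t), 1 ≤ t ≤ lo.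
moves : ℕ → ℕ → List (ℕ × ℕ)
moves a b =
  map (λ k → (a ⊓ b , k)) (upTo (a ⊔ b)) ++
  map (λ t → ((a ⊓ b) ∸ suc t , (a ⊔ b) ∸ suc t)) (upTo (a ⊓ b))

-- Sprague–Grundy function computed with fuel; every move strictly decreases
-- a + b, so fuel suc (a + b) is always sufficient.
Gfuel : ℕ → ℕ → ℕ → ℕ
Gfuel zero    a b = 0
Gfuel (suc f) a b = mex (map (λ { (c , d) → Gfuel f c d }) (moves a b))

G-R : ℕ → ℕ → ℕ
G-R a b = Gfuel (suc (a + b)) a b

module Submission where

open import Defs
open import Data.Nat using (ℕ; _≤_)
open import Data.Product using (_×_)
open import Relation.Binary.PropositionalEquality using (_≡_)

open import Data.Nat using (zero; suc; _<_; _+_; _∸_; _⊓_; _⊔_; _≡ᵇ_; z≤n; s≤s; z<s)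
open import Data.Nat.Properties
open import Data.Nat.Induction using (<-rec)
open import Data.Bool using (true; false; T)
open import Data.Empty using (⊥-elim)
open import Data.List using (List; map; length; upTo; _++_)
open import Data.List.Properties using (length-map; length-++; length-upTo; map-cong-local)
open import Data.List.Relation.Unary.All as All using ()
open import Data.List.Relation.Unary.Any as Any using ()
open import Data.List.Relation.Unary.Any.Properties using (any⁺; any⁻)
open import Data.List.Membership.Propositional using (_∈_; _∉_)
open import Data.List.Membership.Propositional.Properties
  using (∈-map⁺; ∈-map⁻; ∈-++⁺ˡ; ∈-++⁻; ∈-upTo⁺; ∈-upTo⁻)
open import Data.Product using (_,_; proj₁; proj₂; ∃-syntax)
open import Data.Sum using (inj₁; inj₂)
open import Relation.Nullary using (contradiction)
open import Relation.Binary.PropositionalEquality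
  using (refl; sym; trans; cong; subst; _≢_; module ≡-Reasoning)

-- Every move lowers the total number of tokens, so the fuel in Gfuel is
--    irrelevant once it exceeds the total; this yields the fuel-free
--    recursion  G-R a b ≡ mex of the values of the moves.
-- 3. Combining 1 and 2 gives a criterion for G-R a k ≡ k (a ≤ k): row a
--    agrees below column k with a map π permuting [0, k) (witnessed by a
--    right inverse), and no move on both piles from (a , k) has value k.
-- 4. By strong induction on k: row 0 is the identity, row 1 is the
--    rotation 0 ↦ 1 ↦ 2 ↦ 0 (identity from 3 on), row 2 its inverse.
--    Both fix every k ≥ 3, which is the theorem.

∈⇒elemᵇ : ∀ {n xs} → n ∈ xs → T (elemᵇ n xs)
∈⇒elemᵇ {n} n∈xs = any⁺ (n ≡ᵇ_) (Any.map (λ {x} → ≡⇒≡ᵇ n x) n∈xs)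

elemᵇ⇒∈ : ∀ {n} xs → T (elemᵇ n xs) → n ∈ xs
elemᵇ⇒∈ {n} xs t = Any.map (λ {x} → ≡ᵇ⇒≡ n x) (any⁻ (n ≡ᵇ_) xs t)

mexAux-spec : ∀ {xs n} fuel i → (∀ m → m < n → m ∈ xs) → n ∉ xs →
              i ≤ n → n ≤ fuel + i → mexAux fuel i xs ≡ n
mexAux-spec zero i below n∉xs i≤n n≤i = ≤-antisym i≤n n≤i
mexAux-spec {xs} {n} (suc fuel) i below n∉xs i≤n n≤fuel+i
  with elemᵇ i xs in eq | m≤n⇒m<n∨m≡n i≤n
... | true  | inj₁ i<n  =
  mexAux-spec fuel (suc i) below n∉xs i<n (subst (n ≤_) (sym (+-suc fuel i)) n≤fuel+i)
... | true  | inj₂ refl = contradiction (elemᵇ⇒∈ xs (subst T (sym eq) _)) n∉xs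
... | false | inj₁ i<n  = ⊥-elim (subst T eq (∈⇒elemᵇ (below i i<n)))
... | false | inj₂ refl = refl

mex-spec : ∀ {xs n} → (∀ m → m < n → m ∈ xs) → n ∉ xs → n ≤ length xs → mex xs ≡ n
mex-spec below n∉xs n≤len =
  mexAux-spec _ 0 below n∉xs z≤n (subst (_ ≤_) (sym (+-identityʳ _)) n≤len)

options : ℕ → ℕ → List (ℕ × ℕ)
options lo hi =
  map (λ k → (lo , k)) (upTo hi) ++ map (λ t → (lo ∸ suc t , hi ∸ suc t)) (upTo lo)

data Move (lo hi : ℕ) : ℕ × ℕ → Set where
  shrink-larger : ∀ k → k < hi → Move lo hi (lo , k)
  shrink-both   : ∀ t → t < lo → Move lo hi (lo ∸ suc t , hi ∸ suc t)

option⇒Move : ∀ {lo hi q} → q ∈ options lo hi → Move lo hi q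
option⇒Move {lo} {hi} q∈ with ∈-++⁻ (map (λ k → (lo , k)) (upTo hi)) q∈
... | inj₁ q∈ˡ with k , k∈ , refl ← ∈-map⁻ _ q∈ˡ = shrink-larger k (∈-upTo⁻ k∈)
... | inj₂ q∈ʳ with t , t∈ , refl ← ∈-map⁻ _ q∈ʳ = shrink-both t (∈-upTo⁻ t∈)

shrink-larger∈options : ∀ {lo hi k} → k < hi → (lo , k) ∈ options lo hi
shrink-larger∈options {lo} k<hi = ∈-++⁺ˡ (∈-map⁺ (λ k → (lo , k)) (∈-upTo⁺ k<hi))

hi≤length-options : ∀ lo hi → hi ≤ length (options lo hi)
hi≤length-options lo hi
  rewrite length-++ (map (λ k → (lo , k)) (upTo hi))
            {map (λ t → (lo ∸ suc t , hi ∸ suc t)) (upTo lo)}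
        | length-map (λ k → (lo , k)) (upTo hi)
        | length-upTo hi = m≤m+n hi _

Move⇒fewer-tokens : ∀ {lo hi q} → Move lo hi q → proj₁ q + proj₂ q < lo + hi
Move⇒fewer-tokens {lo} (shrink-larger k k<hi) = +-monoʳ-< lo k<hi
Move⇒fewer-tokens {lo} {hi} (shrink-both t t<lo) =
  +-mono-<-≤ (∸-monoʳ-< {lo} z<s t<lo) (m∸n≤m hi (suc t))

⊓+⊔≡+ : ∀ a b → (a ⊓ b) + (a ⊔ b) ≡ a + b
⊓+⊔≡+ a b with ≤-total a b
... | inj₁ a≤b rewrite m≤n⇒m⊓n≡m a≤b | m≤n⇒m⊔n≡n a≤b = refl
... | inj₂ b≤a rewrite m≥n⇒m⊓n≡n b≤a | m≥n⇒m⊔n≡m b≤a = +-comm b a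

move-fewer-tokens : ∀ {a b q} → q ∈ moves a b → proj₁ q + proj₂ q < a + b
move-fewer-tokens {a} {b} {q} p = subst (proj₁ q + proj₂ q <_) (⊓+⊔≡+ a b) (Move⇒fewer-tokens (option⇒Move {a ⊓ b} {a ⊔ b} p))

moves-ordered : ∀ {a b} → a ≤ b → moves a b ≡ options a b
moves-ordered a≤b rewrite m≤n⇒m⊓n≡m a≤b | m≤n⇒m⊔n≡n a≤b = refl

-- Any fuel exceeding the total number of tokens computes the same value,
-- since every recursive call is on a position with fewer tokens.
Gfuel-stable : ∀ f g {a b} → a + b < f → a + b < g → Gfuel f a b ≡ Gfuel g a b
Gfuel-stable (suc f) (suc g) {a} {b} (s≤s a+b≤f) (s≤s a+b≤g) =
  cong mex (map-cong-local (All.tabulate same-value))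
  where
  same-value : ∀ {q} → q ∈ moves a b →
               Gfuel f (proj₁ q) (proj₂ q) ≡ Gfuel g (proj₁ q) (proj₂ q)
  same-value q∈ = Gfuel-stable f g (≤-trans (move-fewer-tokens {a} {b} q∈) a+b≤f)
                                   (≤-trans (move-fewer-tokens {a} {b} q∈) a+b≤g)

value : ℕ × ℕ → ℕ
value (c , d) = G-R c d

G-R-unfold : ∀ a b → G-R a b ≡ mex (map value (moves a b))
G-R-unfold a b = cong mex (map-cong-local (All.tabulate enough-fuel))
  where
  enough-fuel : ∀ {q} → q ∈ moves a b →
                Gfuel (a + b) (proj₁ q) (proj₂ q) ≡ value q
  enough-fuel q∈ = Gfuel-stable (a + b) _ (move-fewer-tokens {a} {b} q∈) ≤-refl

G-R-criterion : ∀ {a b n} → a ≤ b → n ≤ b →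
  (∀ m → m < n → ∃[ k ] k < b × G-R a k ≡ m) →
  (∀ k → k < b → G-R a k ≢ n) →
  (∀ t → t < a → G-R (a ∸ suc t) (b ∸ suc t) ≢ n) →
  G-R a b ≡ n
G-R-criterion {a} {b} {n} a≤b n≤b attained misses-larger misses-both = begin
  G-R a b                        ≡⟨ G-R-unfold a b ⟩
  mex (map value (moves a b))    ≡⟨ cong (λ qs → mex (map value qs)) (moves-ordered a≤b) ⟩
  mex (map value (options a b))  ≡⟨ mex-spec below n∉values n≤length ⟩
  n                              ∎
  where
  open ≡-Reasoning

  below : ∀ m → m < n → m ∈ map value (options a b)
  below m m<n with k , k<b , refl ← attained m m<n =
    ∈-map⁺ value (shrink-larger∈options k<b)

  n∉values : n ∉ map value (options a b)
  n∉values n∈ with q , q∈ , n≡value ← ∈-map⁻ value n∈ | option⇒Move {a} {b} q∈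
  ... | shrink-larger k k<b = misses-larger k k<b (sym n≡value)
  ... | shrink-both t t<a   = misses-both t t<a (sym n≡value)

  n≤length : n ≤ length (map value (options a b))
  n≤length = subst (n ≤_) (sym (length-map value (options a b)))
                   (≤-trans n≤b (hi≤length-options a b))

permuted-row⇒G-R≡k : ∀ {a k} (π π⁻¹ : ℕ → ℕ) → (∀ m → π (π⁻¹ m) ≡ m) →
  (∀ {j} → j < k → π j < k) → (∀ {m} → m < k → π⁻¹ m < k) → a ≤ k →
  (∀ {j} → j < k → G-R a j ≡ π j) →
  (∀ t → t < a → G-R (a ∸ suc t) (k ∸ suc t) ≢ k) →
  G-R a k ≡ k
permuted-row⇒G-R≡k {a} {k} π π⁻¹ π∘π⁻¹ π-< π⁻¹-< a≤k row = G-R-criterion a≤k ≤-refl attained misses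
  where
  attained : ∀ m → m < k → ∃[ j ] j < k × G-R a j ≡ m
  attained m m<k = π⁻¹ m , π⁻¹-< m<k , trans (row (π⁻¹-< m<k)) (π∘π⁻¹ m)

  misses : ∀ j → j < k → G-R a j ≢ k
  misses j j<k eq = <⇒≢ (π-< j<k) (trans (sym (row j<k)) eq)

-- Row 0 is a single Nim heap.
G-R-row0 : ∀ k → G-R 0 k ≡ k
G-R-row0 = <-rec _ λ k row →
  permuted-row⇒G-R≡k (λ j → j) (λ m → m) (λ _ → refl) (λ j<k → j<k) (λ m<k → m<k)
                    z≤n row (λ t ())

-- The rotation 0 ↦ 1 ↦ 2 ↦ 0 of {0, 1, 2}, extended by the identity, and
-- its inverse: these are rows 1 and 2 of G-R.
rot : ℕ → ℕ
rot 0 = 1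
rot 1 = 2
rot 2 = 0
rot k@(suc (suc (suc _))) = k

rot⁻¹ : ℕ → ℕ
rot⁻¹ 0 = 2
rot⁻¹ 1 = 0
rot⁻¹ 2 = 1
rot⁻¹ k@(suc (suc (suc _))) = k

rot∘rot⁻¹ : ∀ m → rot (rot⁻¹ m) ≡ m
rot∘rot⁻¹ 0 = refl
rot∘rot⁻¹ 1 = refl
rot∘rot⁻¹ 2 = refl
rot∘rot⁻¹ (suc (suc (suc _))) = refl

rot⁻¹∘rot : ∀ m → rot⁻¹ (rot m) ≡ m
rot⁻¹∘rot 0 = refl
rot⁻¹∘rot 1 = refl
rot⁻¹∘rot 2 = refl
rot⁻¹∘rot (suc (suc (suc _))) = refl

rot-< : ∀ {j k} → 3 ≤ k → j < k → rot j < k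
rot-< 3≤k (s≤s z≤n) = ≤-trans (s≤s (s≤s z≤n)) 3≤k
rot-< 3≤k (s≤s (s≤s z≤n)) = 3≤k
rot-< 3≤k (s≤s (s≤s (s≤s z≤n))) = ≤-trans (s≤s z≤n) 3≤k
rot-< 3≤k j<k@(s≤s (s≤s (s≤s (s≤s _)))) = j<k

rot⁻¹-< : ∀ {j k} → 3 ≤ k → j < k → rot⁻¹ j < k
rot⁻¹-< 3≤k (s≤s z≤n) = 3≤k
rot⁻¹-< 3≤k (s≤s (s≤s z≤n)) = ≤-trans (s≤s z≤n) 3≤k
rot⁻¹-< 3≤k (s≤s (s≤s (s≤s z≤n))) = ≤-trans (s≤s (s≤s z≤n)) 3≤k
rot⁻¹-< 3≤k j<k@(s≤s (s≤s (s≤s (s≤s _)))) = j<k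

rot-fixes : ∀ {k} → 3 ≤ k → rot k ≡ k
rot-fixes (s≤s (s≤s (s≤s _))) = refl

rot⁻¹-fixes : ∀ {k} → 3 ≤ k → rot⁻¹ k ≡ k
rot⁻¹-fixes (s≤s (s≤s (s≤s _))) = refl

-- Row 1: the only diagonal option of (1 , k) is (0 , k - 1), of value k - 1.
G-R-row1 : ∀ k → G-R 1 k ≡ rot k
G-R-row1 = <-rec _ step
  where
  step : ∀ k → (∀ {j} → j < k → G-R 1 j ≡ rot j) → G-R 1 k ≡ rot k
  step 0 _ = refl
  step 1 _ = refl
  step 2 _ = refl
  step k@(suc k-1@(suc (suc _))) row =
    permuted-row⇒G-R≡k {1} {k} rot rot⁻¹ rot∘rot⁻¹ (rot-< 3≤k) (rot⁻¹-< 3≤k) (s≤s z≤n) row misses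
    where
    3≤k : 3 ≤ k
    3≤k = s≤s (s≤s (s≤s z≤n))
    misses : ∀ t → t < 1 → G-R (1 ∸ suc t) (k ∸ suc t) ≢ k
    misses 0 _ eq = <⇒≢ (n<1+n k-1) (trans (sym (G-R-row0 k-1)) eq)
    misses (suc _) (s≤s ())

-- Row 2: the diagonal options of (2 , k) are (1 , k - 1) and (0 , k - 2),
-- whose values rot (k - 1) and k - 2 are both below k.
G-R-row2 : ∀ k → G-R 2 k ≡ rot⁻¹ k
G-R-row2 = <-rec _ step
  where
  step : ∀ k → (∀ {j} → j < k → G-R 2 j ≡ rot⁻¹ j) → G-R 2 k ≡ rot⁻¹ k
  step 0 _ = refl
  step 1 _ = refl
  step 2 _ = refl
  step k@(suc k-1@(suc k-2@(suc _))) row =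
    permuted-row⇒G-R≡k {2} {k} rot⁻¹ rot rot⁻¹∘rot (rot⁻¹-< 3≤k) (rot-< 3≤k) (s≤s (s≤s z≤n)) row misses
    where
    3≤k : 3 ≤ k
    3≤k = s≤s (s≤s (s≤s z≤n))
    misses : ∀ t → t < 2 → G-R (2 ∸ suc t) (k ∸ suc t) ≢ k
    misses 0 _ eq = <⇒≢ (rot-< 3≤k (n<1+n k-1)) (trans (sym (G-R-row1 k-1)) eq)
    misses 1 _ eq = <⇒≢ (m≤n⇒m≤1+n (n<1+n k-2)) (trans (sym (G-R-row0 k-2)) eq)
    misses (suc (suc _)) (s≤s (s≤s ()))

lemma2p11 : (a : ℕ) → 3 ≤ a → (G-R 1 a ≡ a) × (G-R 2 a ≡ a)
lemma2p11 a 3≤a = trans (G-R-row1 a) (rot-fixes 3≤a) , trans (G-R-row2 a) (rot⁻¹-fixes 3≤a)
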